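{- Let $a\geq 3$ and $m\geq 2a^2-a+2$ be integers, let $C(m,a)=\left\lceil\frac{m-1}{a}\left\lceil\frac{m-1}{a}\right\rceil\right\rceil$, and suppose the set $\{1,\ldots,C(m,a)\}$ is colored red and blue so that there is no monochromatic solution of $x_1+\cdots+x_{m-1}=ax_m$, with both $a-2$ and $a-1$ red. If $d$ is an integer such that $a\mid d$ and $m-1\leq d\leq 2m-2$, then $\frac{d}{a}$ is blue.
   Context: A solution is an assignment of values in $\{1,\ldots,C(m,a)\}$ to $x_1,\ldots,x_m$ (not necessarily distinct) making the equation true; it is monochromatic if all the values $x_1,\ldots,x_m$ have the same color. -}

module Defs where

open import Data.Nat using (ℕ; zero; suc; _+_; _*_; _∸_; _≤_; _/_; NonZero)
open import Data.Nat.Divisibility using (_∣_)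
open import Data.Bool using (Bool; true; false)
open import Data.Fin using (Fin)
open import Data.Product using (_×_; Σ)
open import Relation.Binary.PropositionalEquality using (_≡_)

⌈_/_⌉ : (n k : ℕ) → .{{NonZero k}} → ℕ
⌈ n / k ⌉ = (n + k ∸ 1) / k

Σfin : (n : ℕ) → (Fin n → ℕ) → ℕ
Σfin zero f = 0
Σfin (suc n) f = f Fin.zero + Σfin n (λ i → f (Fin.suc i))

-- C(m,a) = ⌈ ((m-1)/a) ⌈ (m-1)/a ⌉ ⌉ = ⌈ (m-1) * ⌈ (m-1)/a ⌉ / a ⌉
C : (m a : ℕ) → .{{NonZero a}} → ℕ
C m a = ⌈ (m ∸ 1) * ⌈ (m ∸ 1) / a ⌉ / a ⌉

Colouring : Set
Colouring = ℕ → Bool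

red blue : Bool
red = true
blue = false

InRange : ℕ → ℕ → Set
InRange N x = 1 ≤ x × x ≤ N

-- A monochromatic solution in {1,…,N} of x₁ + ⋯ + x_{m-1} = a x_m.
-- Variables: y : Fin (m-1) → ℕ are x₁,…,x_{m-1}, and z is x_m.
MonoSolution : (m a N : ℕ) → Colouring → Set
MonoSolution m a N c =
  Σ (Fin (m ∸ 1) → ℕ) λ y → Σ ℕ λ z → Σ Bool λ col →
    ((i : Fin (m ∸ 1)) → InRange N (y i) × c (y i) ≡ col) ×
    InRange N z × c z ≡ col ×
    Σfin (m ∸ 1) y ≡ a * z

module Submission where

-- Proof idea.  Write n = m − 1 = a·P + r with 0 ≤ r < a.  The size hypothesis on m
-- gives P ≥ 2a − 1 and C(m,a) ≥ P², so every number used below lies in [1, C(m,a)].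
--
-- The only tool is "forcing": if a·z is a sum of n numbers of some colour, then z
-- must have the other colour, since otherwise there is a monochromatic solution.
-- (1) As a − 2 and a − 1 are red, and the sums of n numbers from {a−2, a−1} are
--     exactly the integers in [n(a−2), n(a−1)], every z with n(a−2) ≤ a·z ≤ n(a−1)
--     is blue; this contains the window W = [(a−2)P + r, (a−1)P + r − 1].
-- (2) For a ≥ 4 this blue window forces 1 and 2 to be red: a blue 1 (resp. 2)
--     together with a − 1 (resp. a − 3) summands from W would give a blue solution.
--     For a = 3 the numbers 1, 2 are a − 2, a − 1 themselves.
-- (3) Now 1 and 2 are red, so as in (1) any z with n ≤ a·z ≤ 2n is blue; for
--     z = d/a the hypotheses on d say exactly this.

open import Defs
open import Data.Nat using (ℕ; zero; suc; _+_; _*_; _∸_; _≤_; _<_; _/_; _%_; NonZero; z≤n; s≤s; s≤s⁻¹; _≤?_)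
open import Data.Nat.Properties
open import Data.Nat.DivMod using (m≡m%n+[m/n]*n; m%n<n; m*n/n≡m; m*[n/m]≡n; m/n*n≤m; /-monoˡ-≤)
open import Data.Nat.Divisibility using (_∣_)
open import Data.Nat.Tactic.RingSolver using (solve-∀)
open import Data.Bool using (Bool; not)
open import Data.Bool.Properties using (¬-not; not-¬)
open import Data.Fin using (Fin)
open import Data.Product using (Σ; _×_; _,_; proj₁; proj₂)
open import Data.Sum using (inj₁; inj₂)
open import Relation.Nullary using (¬_; yes; no)
open import Relation.Binary.PropositionalEquality

data SumOf (S : ℕ → Set) : ℕ → ℕ → Set where
  []  : SumOf S 0 0
  _∷_ : ∀ {x n T} → S x → SumOf S n T → SumOf S (suc n) (x + T)

infixr 5 _∷_ _++ₛ_

summands : ∀ {S n T} → SumOf S n T →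
           Σ (Fin n → ℕ) λ y → ((i : Fin n) → S (y i)) × Σfin n y ≡ T
summands [] = (λ ()) , (λ ()) , refl
summands {S} (_∷_ {x} {n} Sx s) with summands s
... | y , Sy , sum≡ = extend , S-extend , cong (x +_) sum≡
  where
  extend : Fin (suc n) → ℕ
  extend Fin.zero    = x
  extend (Fin.suc i) = y i
  S-extend : (i : Fin (suc n)) → S (extend i)
  S-extend Fin.zero    = Sx
  S-extend (Fin.suc i) = Sy i

_++ₛ_ : ∀ {S k j T U} → SumOf S k T → SumOf S j U → SumOf S (k + j) (T + U)
[] ++ₛ t = t
_++ₛ_ {S} (_∷_ {x} Sx s) t = subst (SumOf S _) (sym (+-assoc x _ _)) (Sx ∷ s ++ₛ t)

replicateₛ : ∀ {S v} k → S v → SumOf S k (k * v)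
replicateₛ zero    Sv = []
replicateₛ (suc k) Sv = Sv ∷ replicateₛ k Sv

-- If S holds on the whole interval [lo, hi], then every T with n·lo ≤ T ≤ n·hi is a
-- sum of n elements of S: take lo first while the rest still fits below (n−1)·hi,
-- and otherwise one middle term followed by n − 1 copies of hi.
intervalₛ : ∀ {S lo hi} → lo ≤ hi → (∀ {x} → lo ≤ x → x ≤ hi → S x) →
            ∀ n {T} → n * lo ≤ T → T ≤ n * hi → SumOf S n T
intervalₛ {S} _ _ zero {T} _ T≤0 = subst (SumOf S 0) (sym (n≤0⇒n≡0 T≤0)) []
intervalₛ {S} {lo} {hi} lo≤hi S-on (suc n) {T} lo+nlo≤T T≤hi+nhi with T ≤? lo + n * hi
... | yes T≤lo+nhi =
  subst (SumOf S (suc n)) (m+[n∸m]≡n (m+n≤o⇒m≤o lo lo+nlo≤T))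
    (S-on ≤-refl lo≤hi ∷ intervalₛ lo≤hi S-on n
       (m+n≤o⇒m≤o∸n (n * lo) (subst (_≤ T) (+-comm lo (n * lo)) lo+nlo≤T))
       (m≤n+o⇒m∸n≤o T lo T≤lo+nhi))
... | no T≰lo+nhi =
  subst (SumOf S (suc n)) (m∸n+n≡m (m+n≤o⇒n≤o lo lo+nhi≤T))
    (S-on (m+n≤o⇒m≤o∸n lo lo+nhi≤T)
          (m≤n+o⇒m∸n≤o T (n * hi) (subst (T ≤_) (+-comm hi (n * hi)) T≤hi+nhi))
     ∷ replicateₛ n (S-on lo≤hi ≤-refl))
  where
  lo+nhi≤T : lo + n * hi ≤ T
  lo+nhi≤T = <⇒≤ (≰⇒> T≰lo+nhi)

Coloured : ℕ → Colouring → Bool → ℕ → Set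
Coloured N c col x = InRange N x × c x ≡ col

ColouredOn : ℕ → Colouring → Bool → ℕ → ℕ → Set
ColouredOn N c col lo hi = ∀ {x} → lo ≤ x → x ≤ hi → Coloured N c col x

module Forcing {m a N : ℕ} {c : Colouring} (noMono : ¬ MonoSolution m a N c) where

  other-colour : ∀ {col z} → InRange N z →
                 SumOf (Coloured N c col) (m ∸ 1) (a * z) → c z ≡ not col
  other-colour {col} {z} z∈ s with summands s
  ... | y , coloured , sum≡ = ¬-not λ cz≡col → noMono (y , z , col , coloured , z∈ , cz≡col , sum≡)

  pair-forcing : ∀ {col u z} → Coloured N c col u → Coloured N c col (suc u) →
                 InRange N z → (m ∸ 1) * u ≤ a * z → a * z ≤ (m ∸ 1) * suc u →
                 c z ≡ not col
  pair-forcing {col} {u} u-col u+1-col z∈ lower upper =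
    other-colour z∈ (intervalₛ (n≤1+n u) between (m ∸ 1) lower upper)
    where
    between : ColouredOn N c col u (suc u)
    between u≤x x≤u+1 with m≤n⇒m<n∨m≡n x≤u+1
    ... | inj₁ x<u+1 rewrite ≤-antisym (s≤s⁻¹ x<u+1) u≤x = u-col
    ... | inj₂ refl = u+1-col

  mixed-forcing : ∀ {col v lo hi z} k j → m ∸ 1 ≡ k + j →
                  Coloured N c col v → lo ≤ hi → ColouredOn N c col lo hi → InRange N z →
                  k * v + j * lo ≤ a * z → a * z ≤ k * v + j * hi → c z ≡ not col
  mixed-forcing {col} {v} {lo} {hi} {z} k j n≡k+j v-col lo≤hi on z∈ lower upper =
    other-colour z∈ (subst₂ (SumOf (Coloured N c col)) (sym n≡k+j) (m+[n∸m]≡n kv≤az)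
      (replicateₛ k v-col ++ₛ intervalₛ lo≤hi on j
         (m+n≤o⇒m≤o∸n (j * lo) (subst (_≤ a * z) (+-comm (k * v) (j * lo)) lower))
         (m≤n+o⇒m∸n≤o (a * z) (k * v) upper)))
    where
    kv≤az : k * v ≤ a * z
    kv≤az = m+n≤o⇒m≤o (k * v) lower

≤-by-slack : ∀ {x y} s {t} → x + s ≡ y + t → t ≤ s → x ≤ y
≤-by-slack {x} {y} s {t} eq t≤s =
  +-cancelʳ-≤ s x y (≤-trans (≤-reflexive eq) (+-monoʳ-≤ y t≤s))

≤-by-identity : ∀ {x y} s → x + s ≡ y → x ≤ y
≤-by-identity {x} s eq = subst (x ≤_) eq (m≤m+n x s)

positive-factor : ∀ a z → 1 ≤ a * z → 1 ≤ z
positive-factor a zero    1≤a*0 = subst (1 ≤_) (*-zeroʳ a) 1≤a*0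
positive-factor a (suc z) _     = s≤s z≤n

floor≤ceil : ∀ x a .{{_ : NonZero a}} → x / a ≤ ⌈ x / a ⌉
floor≤ceil x a@(suc a-1) =
  /-monoˡ-≤ a (subst (x ≤_) (sym (+-∸-assoc x {a} {1} (s≤s z≤n))) (m≤m+n x a-1))

floor-bounds : ∀ x a .{{_ : NonZero a}} → a * (x / a) ≤ x × x ≤ a * (x / a) + (a ∸ 1)
floor-bounds x a@(suc a-1) =
  subst (_≤ x) (*-comm (x / a) a) (m/n*n≤m x a) ,
  (begin
    x                       ≡⟨ m≡m%n+[m/n]*n x a ⟩
    x % a + x / a * a       ≤⟨ +-monoˡ-≤ (x / a * a) (s≤s⁻¹ (m%n<n x a)) ⟩
    a-1 + x / a * a         ≡⟨ +-comm a-1 (x / a * a) ⟩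
    x / a * a + a-1         ≡⟨ cong (_+ a-1) (*-comm (x / a) a) ⟩
    a * (x / a) + a-1       ∎)
  where open ≤-Reasoning

2P+2≤P² : ∀ P → 3 ≤ P → 2 * P + 2 ≤ P * P
2P+2≤P² P 3≤P with m≤n⇒∃[o]m+o≡n 3≤P
... | g , refl = ≤-by-identity (1 + 4 * g + g * g) (square g)
  where
  square : ∀ g → 2 * (3 + g) + 2 + (1 + 4 * g + g * g) ≡ (3 + g) * (3 + g)
  square = solve-∀

record Division (a m : ℕ) .{{_ : NonZero a}} : Set where
  field
    P r        : ℕ
    n≡aP+r     : m ∸ 1 ≡ a * P + r
    r<a        : r < a
    2a≤1+P     : 2 * a ≤ 1 + P
    P²≤C       : P * P ≤ C m a

divide : ∀ a m .{{_ : NonZero a}} → 2 * a * a ∸ a + 2 ≤ m → Division a m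
divide a m large = record
  { P = P ; r = n % a ; n≡aP+r = n≡aP+r ; r<a = m%n<n n a
  ; 2a≤1+P = 2a≤1+P ; P²≤C = P²≤C }
  where
  n = m ∸ 1
  P = n / a
  open ≤-Reasoning

  n≡aP+r : n ≡ a * P + n % a
  n≡aP+r = trans (m≡m%n+[m/n]*n n a) (trans (+-comm (n % a) (P * a)) (cong (_+ n % a) (*-comm P a)))

  aP≤n : a * P ≤ n
  aP≤n = ≤-by-identity (n % a) (sym n≡aP+r)

  -- (2a − 1)·a = 2a² − a ≤ n, so 2a − 1 ≤ ⌊n/a⌋.
  2a≤1+P : 2 * a ≤ 1 + P
  2a≤1+P = begin
    2 * a                       ≤⟨ m≤n+m∸n (2 * a) 1 ⟩
    1 + (2 * a ∸ 1)             ≡⟨ cong suc (sym (m*n/n≡m (2 * a ∸ 1) a)) ⟩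
    1 + (2 * a ∸ 1) * a / a     ≤⟨ s≤s (/-monoˡ-≤ a (begin
      (2 * a ∸ 1) * a               ≡⟨ *-distribʳ-∸ a (2 * a) 1 ⟩
      2 * a * a ∸ 1 * a             ≡⟨ cong (2 * a * a ∸_) (*-identityˡ a) ⟩
      2 * a * a ∸ a                 ≤⟨ m+n≤o⇒m≤o∸n (2 * a * a ∸ a) (≤-trans (+-monoʳ-≤ (2 * a * a ∸ a) (s≤s z≤n)) large) ⟩
      n                             ∎)) ⟩
    1 + P                       ∎

  -- P² ≤ n·⌈n/a⌉ / a ≤ C(m,a), using a·P ≤ n and P ≤ ⌈n/a⌉.
  P²≤C : P * P ≤ C m a
  P²≤C = begin
    P * P                       ≡⟨ sym (m*n/n≡m (P * P) a) ⟩
    P * P * a / a               ≤⟨ /-monoˡ-≤ a (begin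
      P * P * a                     ≡⟨ rearrange P a ⟩
      a * P * P                     ≤⟨ *-mono-≤ aP≤n (floor≤ceil n a) ⟩
      n * ⌈ n / a ⌉                 ∎) ⟩
    n * ⌈ n / a ⌉ / a           ≤⟨ floor≤ceil (n * ⌈ n / a ⌉) a ⟩
    C m a                       ∎
    where
    rearrange : ∀ P a → P * P * a ≡ a * P * P
    rearrange = solve-∀

-- Write a = 4 + b, P = 7 + 2b + e (so P ≥ 2a − 1) and n = a·P + r with r ≤ a − 1.
-- The blue window is W = [lo, hi] = [(a−2)·P + r, (a−1)·P + r − 1].
module LowColours (b e r : ℕ) (r≤a-1 : r ≤ 3 + b) {m N : ℕ} {c : Colouring}
  (noMono : ¬ MonoSolution m (4 + b) N c)
  (n≡aP+r : m ∸ 1 ≡ (4 + b) * (7 + 2 * b + e) + r)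
  (P²≤N : (7 + 2 * b + e) * (7 + 2 * b + e) ≤ N)
  (a-2-red : c (2 + b) ≡ red) (a-1-red : c (3 + b) ≡ red) where

  open Forcing {m} {4 + b} {N} {c} noMono

  a P δ lo hi : ℕ
  a  = 4 + b
  P  = 7 + 2 * b + e
  δ  = 6 + 2 * b + e
  lo = (2 + b) * P + r
  hi = lo + δ

  r≤s : ∀ s → r ≤ (3 + b) + s
  r≤s s = ≤-trans r≤a-1 (m≤m+n (3 + b) s)

  lo≤hi : lo ≤ hi
  lo≤hi = m≤m+n lo δ

  -- W lies in [1, N]: its top hi is at most P², and its bottom is positive.
  hi≤N : hi ≤ N
  hi≤N = ≤-trans (≤-by-slack ((3 + b) + ((2 + e) * P + (2 + b) * δ)) (hi≤P² b e r) (r≤s _)) P²≤N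
    where
    hi≤P² : ∀ b e r → let P = 7 + 2 * b + e ; δ = 6 + 2 * b + e in
            (2 + b) * P + r + δ + ((3 + b) + ((2 + e) * P + (2 + b) * δ)) ≡ P * P + r
    hi≤P² = solve-∀

  in-W : ∀ {x} → lo ≤ x → x ≤ hi → InRange N x
  in-W lo≤x x≤hi = ≤-trans (s≤s z≤n) lo≤x , ≤-trans x≤hi hi≤N

  -- So do 1, …, a − 1, since a − 1 ≤ P ≤ lo.
  below-a : ∀ {x} → 1 ≤ x → x ≤ 3 + b → InRange N x
  below-a 1≤x x≤a-1 = 1≤x , ≤-trans x≤a-1 (≤-trans a-1≤lo (≤-trans lo≤hi hi≤N))
    where
    a-1≤lo : 3 + b ≤ lo
    a-1≤lo = ≤-trans (≤-by-identity (4 + b + e) (split b e)) (≤-trans (m≤m+n P ((1 + b) * P)) (m≤m+n _ r))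
      where
      split : ∀ b e → 3 + b + (4 + b + e) ≡ 7 + 2 * b + e
      split = solve-∀

  -- Step (1): W is blue, because n(a−2) ≤ a·lo and a·hi ≤ n(a−1).
  W-blue : ColouredOn N c blue lo hi
  W-blue {x} lo≤x x≤hi =
    in-W lo≤x x≤hi ,
    pair-forcing (below-a (s≤s z≤n) (n≤1+n _) , a-2-red) (below-a (s≤s z≤n) ≤-refl , a-1-red)
      (in-W lo≤x x≤hi)
      (subst (λ k → k * (2 + b) ≤ a * x) (sym n≡aP+r)
        (≤-trans (≤-by-identity (2 * r) (bottom b e r)) (*-monoʳ-≤ a lo≤x)))
      (subst (λ k → a * x ≤ k * (3 + b)) (sym n≡aP+r)
        (≤-trans (*-monoʳ-≤ a x≤hi) (≤-by-slack a (top b e r) (≤-trans r≤a-1 (n≤1+n _)))))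
    where
    bottom : ∀ b e r → let a = 4 + b ; P = 7 + 2 * b + e in
             (a * P + r) * (2 + b) + 2 * r ≡ a * ((2 + b) * P + r)
    bottom = solve-∀
    top : ∀ b e r → let a = 4 + b ; P = 7 + 2 * b + e in
          a * ((2 + b) * P + r + (6 + 2 * b + e)) + a ≡ (a * P + r) * (3 + b) + r
    top = solve-∀

  -- Step (2) for 1: a blue 1 would make a·hi the sum of n − (a−1) ones and a − 1
  -- terms of W, so hi would be red.
  one-red : c 1 ≡ red
  one-red = ¬-not λ 1-blue →
    not-¬ (proj₂ (W-blue lo≤hi ≤-refl))
      (mixed-forcing k (3 + b) (trans n≡aP+r (split b e r)) (below-a ≤-refl (s≤s z≤n) , 1-blue)
         lo≤hi W-blue (in-W lo≤hi ≤-refl)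
         (≤-by-identity ((2 + b) * δ + (1 + b)) (lower b e r))
         (≤-by-identity (5 + b + e) (upper b e r)))
    where
    -- k = n − (a − 1), the number of ones.
    k : ℕ
    k = (3 + b) * P + (4 + b + e) + r
    split : ∀ b e r → let P = 7 + 2 * b + e in
            (4 + b) * P + r ≡ (3 + b) * P + (4 + b + e) + r + (3 + b)
    split = solve-∀
    -- k + (a−1)·lo ≤ a·hi ≤ k + (a−1)·hi.
    lower : ∀ b e r → let P = 7 + 2 * b + e ; δ = 6 + 2 * b + e ; lo = (2 + b) * P + r in
            ((3 + b) * P + (4 + b + e) + r) * 1 + (3 + b) * lo + ((2 + b) * δ + (1 + b))
              ≡ (4 + b) * (lo + δ)
    lower = solve-∀
    upper : ∀ b e r → let P = 7 + 2 * b + e ; hi = (2 + b) * P + r + (6 + 2 * b + e) in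
            (4 + b) * hi + (5 + b + e) ≡ ((3 + b) * P + (4 + b + e) + r) * 1 + (3 + b) * hi
    upper = solve-∀

  -- Step (2) for 2: a blue 2 would make a·z, for a suitable z in W, the sum of
  -- n − (a−3) twos and a − 3 terms of W.  Take for a·z the largest multiple of a
  -- below U = 2(n − (a−3)) + (a−3)·hi; the window below U is wide enough.
  two-red : c 2 ≡ red
  two-red = ¬-not λ 2-blue →
    not-¬ (proj₂ (W-blue lo≤z z≤hi))
      (mixed-forcing k (1 + b) (trans n≡aP+r (split b e r)) (below-a (s≤s z≤n) (s≤s (s≤s z≤n)) , 2-blue)
         lo≤hi W-blue (in-W lo≤z z≤hi) lower az≤U)
    where
    -- n = k + (a − 3), where k is the number of twos.
    split : ∀ b e r → let P = 7 + 2 * b + e in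
            (4 + b) * P + r ≡ (3 + b) * P + (6 + b + e) + r + (1 + b)
    split = solve-∀
    -- a·lo + (a−1) ≤ U, hence lo ≤ z.
    window-above-lo : ∀ b e r → let P = 7 + 2 * b + e ; lo = (2 + b) * P + r in
      (4 + b) * lo + (3 + b) + ((3 + b) + (12 + b + 3 * e))
        ≡ ((3 + b) * P + (6 + b + e) + r) * 2 + (1 + b) * (lo + (6 + 2 * b + e)) + r
    window-above-lo = solve-∀
    -- 2k + (a−3)·lo + (a−1) ≤ U, hence 2k + (a−3)·lo ≤ a·z.
    window-wide : ∀ b e r → let P = 7 + 2 * b + e ; δ = 6 + 2 * b + e ; lo = (2 + b) * P + r in
      ((3 + b) * P + (6 + b + e) + r) * 2 + (1 + b) * lo + (3 + b) + (3 + b + e + b * δ)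
        ≡ ((3 + b) * P + (6 + b + e) + r) * 2 + (1 + b) * (lo + δ)
    window-wide = solve-∀
    -- U ≤ a·hi, hence z ≤ hi.
    U≤a·hi : ∀ b e r → let P = 7 + 2 * b + e ; hi = (2 + b) * P + r + (6 + 2 * b + e) in
      ((3 + b) * P + (6 + b + e) + r) * 2 + (1 + b) * hi + (b * P + r + (6 + 4 * b + e))
        ≡ (4 + b) * hi
    U≤a·hi = solve-∀
    k U z : ℕ
    k = (3 + b) * P + (6 + b + e) + r
    U = k * 2 + (1 + b) * hi
    z = U / a
    az≤U : a * z ≤ U
    az≤U = proj₁ (floor-bounds U a)
    U≤az+a-1 : U ≤ a * z + (3 + b)
    U≤az+a-1 = proj₂ (floor-bounds U a)
    lo≤z : lo ≤ z
    lo≤z = *-cancelˡ-≤ a (+-cancelʳ-≤ (3 + b) (a * lo) (a * z)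
      (≤-trans (≤-by-slack ((3 + b) + (12 + b + 3 * e)) (window-above-lo b e r) (r≤s _)) U≤az+a-1))
    z≤hi : z ≤ hi
    z≤hi = *-cancelˡ-≤ a (≤-trans az≤U (≤-by-identity (b * P + r + (6 + 4 * b + e)) (U≤a·hi b e r)))
    lower : k * 2 + (1 + b) * lo ≤ a * z
    lower = +-cancelʳ-≤ (3 + b) _ (a * z)
      (≤-trans (≤-by-identity (3 + b + e + b * δ) (window-wide b e r)) U≤az+a-1)

one-and-two-red : ∀ a {m c} .{{_ : NonZero a}} → 3 ≤ a → Division a m →
                  ¬ MonoSolution m a (C m a) c → c (a ∸ 2) ≡ red → c (a ∸ 1) ≡ red →
                  c 1 ≡ red × c 2 ≡ red
one-and-two-red 1 (s≤s ())
one-and-two-red 2 (s≤s (s≤s ()))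
one-and-two-red 3 _ _ _ 1-red 2-red = 1-red , 2-red
one-and-two-red (suc (suc (suc (suc b)))) {m} {c} _ D noMono a-2-red a-1-red =
  large-a P (s≤s⁻¹ (subst (_≤ 1 + P) (double b) 2a≤1+P)) n≡aP+r P²≤C
  where
  open Division D
  double : ∀ b → 2 * (4 + b) ≡ 1 + (7 + 2 * b)
  double = solve-∀
  large-a : ∀ P → 7 + 2 * b ≤ P → m ∸ 1 ≡ (4 + b) * P + r → P * P ≤ C m (4 + b) →
            c 1 ≡ red × c 2 ≡ red
  large-a P 2a-1≤P n≡ P²≤N with m≤n⇒∃[o]m+o≡n 2a-1≤P
  ... | e , refl = one-red , two-red
    where open LowColours b e r (s≤s⁻¹ r<a) {m} noMono n≡ P²≤N a-2-red a-1-red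

-- Step (3): once 1 and 2 are red, z = d/a is blue, because a·z = d is a sum of n
-- numbers from {1, 2}, and 1 ≤ z ≤ 2P + 2 ≤ P² ≤ C(m,a).
quotient-blue : ∀ a {m c} .{{_ : NonZero a}} → 3 ≤ a → 2 ≤ m → Division a m →
                ¬ MonoSolution m a (C m a) c → c 1 ≡ red → c 2 ≡ red →
                ∀ d → a ∣ d → m ∸ 1 ≤ d → d ≤ 2 * m ∸ 2 → c (d / a) ≡ blue
quotient-blue a {m} {c} 3≤a 2≤m D noMono 1-red 2-red d a∣d n≤d d≤2n =
  pair-forcing (up-to-2P+2 ≤-refl (≤-trans (s≤s z≤n) 2≤2P+2) , 1-red) (up-to-2P+2 (s≤s z≤n) 2≤2P+2 , 2-red)
    (up-to-2P+2 (positive-factor a z (subst (1 ≤_) (sym az≡d) (≤-trans 1≤n n≤d))) z≤2P+2)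
    (subst₂ _≤_ (sym (*-identityʳ (m ∸ 1))) (sym az≡d) n≤d)
    az≤2n
  where
  open Division D
  open Forcing {m} {a} {C m a} {c} noMono
  open ≤-Reasoning
  z = d / a
  az≡d : a * z ≡ d
  az≡d = m*[n/m]≡n a∣d
  1≤n : 1 ≤ m ∸ 1
  1≤n = ∸-monoˡ-≤ 1 2≤m
  3≤P : 3 ≤ P
  3≤P = ≤-trans (s≤s (s≤s (s≤s z≤n))) (s≤s⁻¹ (≤-trans (*-monoʳ-≤ 2 3≤a) 2a≤1+P))
  2≤2P+2 : 2 ≤ 2 * P + 2
  2≤2P+2 = m≤n+m 2 (2 * P)
  up-to-2P+2 : ∀ {x} → 1 ≤ x → x ≤ 2 * P + 2 → InRange (C m a) x
  up-to-2P+2 1≤x x≤ = 1≤x , ≤-trans x≤ (≤-trans (2P+2≤P² P 3≤P) P²≤C)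
  az≤2n : a * z ≤ (m ∸ 1) * 2
  az≤2n = subst₂ _≤_ (sym az≡d) (sym (trans (*-distribʳ-∸ 2 m 1) (cong (_∸ 2) (*-comm m 2)))) d≤2n
  z≤2P+2 : z ≤ 2 * P + 2
  z≤2P+2 = *-cancelˡ-≤ a (begin
    a * z              ≤⟨ az≤2n ⟩
    (m ∸ 1) * 2        ≡⟨ cong (_* 2) n≡aP+r ⟩
    (a * P + r) * 2    ≤⟨ *-monoˡ-≤ 2 (+-monoʳ-≤ (a * P) (<⇒≤ r<a)) ⟩
    (a * P + a) * 2    ≡⟨ factor a P ⟩
    a * (2 * P + 2)    ∎)
    where
    factor : ∀ a P → (a * P + a) * 2 ≡ a * (2 * P + 2)
    factor = solve-∀

lemma9 : (a m : ℕ) → .{{_ : NonZero a}} → 3 ≤ a → 2 * a * a ∸ a + 2 ≤ m →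
    (c : Colouring) → ¬ MonoSolution m a (C m a) c →
    c (a ∸ 2) ≡ red → c (a ∸ 1) ≡ red →
    (d : ℕ) → a ∣ d → m ∸ 1 ≤ d → d ≤ 2 * m ∸ 2 →
    c (d / a) ≡ blue
lemma9 a m 3≤a large c noMono a-2-red a-1-red =
  let D               = divide a m large
      (1-red , 2-red) = one-and-two-red a 3≤a D noMono a-2-red a-1-red
  in quotient-blue a 3≤a (≤-trans (m≤n+m 2 _) large) D noMono 1-red 2-red
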